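{- Let $F$ be a CNF formula, $(T,\delta)$ a decomposition tree of $I(F)$, and let $x,y,z$ be nodes of $T$ such that $x$ and $y$ are the children of $z$. Let $s$ be a proper shape for $z$, and let $P=\{(s_x,s_y)\in\mathrm{Gen}_z(s): s_x\text{ and }s_y\text{ are proper}\}$. Then $$n_z(s)=\sum_{(s_x,s_y)\in P} n_x(s_x)\,n_y(s_y).$$
   Context: A clause is a finite set of literals (variables $x$ or negations $\bar x$) not containing both $x$ and $\bar x$; a CNF formula $F$ is a finite set of clauses; $\mathrm{var}(C)$, $\mathrm{var}(F)$ denote occurring variables. The incidence graph $I(F)$ has vertex set $\mathrm{var}(F)\cup F$ and edges $Cx$ for $x\in\mathrm{var}(C)$. A decomposition tree of a graph is a pair $(T,\delta)$ with $T$ a rooted binary tree and $\delta$ a bijection from the leaves of $T$ to the vertex set. For a set of variables $X$, $2^X$ is the set of maps $\sigma:X\to\{0,1\}$ ($\sigma(\bar x)=1-\sigma(x)$); $\sigma$ satisfies clause $C$ if $\sigma(\ell)=1$ for some $\ell\in C$ with variable in $X$. For a set of clauses $G$, $G(\sigma)$ is the set of clauses of $G$ satisfied by $\sigma$, and $\mathrm{Proj}(G,X)=\{G(\sigma):\sigma\in2^X\}$. For a node $z$ of $T$ let $T_z$ be the subtree rooted at $z$ with leaf set $L(T_z)$; $\mathrm{var}_z=\mathrm{var}(F)\cap\delta(L(T_z))$, $F_z=F\cap\delta(L(T_z))$, $\overline{F_z}=F\setminus F_z$, $\overline{\mathrm{var}_z}=\mathrm{var}(F)\setminus\mathrm{var}_z$.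 A shape for $z$ is a pair $(\mathit{out},\mathit{in})$ with $\mathit{out}\subseteq\overline{F_z}$, $\mathit{in}\subseteq F_z$; $\mathcal{S}_z$ is the set of shapes for $z$. An assignment $\tau\in2^{\mathrm{var}_z}$ is of shape $(\mathit{out},\mathit{in})$ if (i) $\overline{F_z}(\tau)=\mathit{out}$ and (ii) every clause $C\in F_z$ is satisfied by $\tau$ or belongs to $\mathit{in}$. $n_z(s)$ is the number of assignments in $2^{\mathrm{var}_z}$ of shape $s$. The shape is proper if $\mathit{out}\in\mathrm{Proj}(\overline{F_z},\mathrm{var}_z)$ and $\mathit{in}\in\mathrm{Proj}(F_z,\overline{\mathrm{var}_z})$. If $x,y$ are the children of $z$, shapes $(\mathit{out}_x,\mathit{in}_x)\in\mathcal{S}_x$ and $(\mathit{out}_y,\mathit{in}_y)\in\mathcal{S}_y$ generate $(\mathit{out}_z,\mathit{in}_z)\in\mathcal{S}_z$ if (1) $\mathit{out}_z=(\mathit{out}_x\cup\mathit{out}_y)\cap\overline{F_z}$, (2) $\mathit{in}_x=(\mathit{in}_z\cup\mathit{out}_y)\cap F_x$, and (3) $\mathit{in}_y=(\mathit{in}_z\cup\mathit{out}_x)\cap F_y$. $\mathrm{Gen}_z(s)$ is the set of pairs in $\mathcal{S}_x\times\mathcal{S}_y$ that generate $s$. -}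

module Defs where

open import Data.Bool using (Bool; true; false; _∧_; _∨_; not; if_then_else_; T)
open import Data.Nat using (ℕ; zero; suc; _*_)
open import Data.Fin using (Fin)
import Data.Fin as Fin
open import Data.Fin.Subset using (Subset; _∩_; _∪_; ∁; _⊆_)
open import Data.Fin.Subset.Properties using (_⊆?_)
open import Data.Vec using (Vec; []; _∷_; lookup; tabulate)
open import Data.Vec.Properties using (≡-dec)
open import Data.List using (List; []; _∷_; map; _++_; allFin; filterᵇ; length; cartesianProduct)
open import Data.Bool.ListAction using (any; all)
open import Data.Nat.ListAction using (sum)
open import Data.List.Membership.Propositional using (_∈_)
open import Data.List.Relation.Unary.Unique.Propositional using (Unique)
open import Data.Maybe using (Maybe; just; nothing; is-just)
open import Data.Product using (Σ; _×_; _,_; proj₁; proj₂)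
open import Data.Sum using (_⊎_; inj₁; inj₂)
open import Relation.Nullary.Decidable using (⌊_⌋)
import Data.Bool.Properties as BoolP

-- A clause is a finite set of literals containing no complementary pair;
-- we represent it by its "sign vector": entry v is
--   just true  : the positive literal v is in the clause,
--   just false : the negative literal v̄ is in the clause,
--   nothing    : v does not occur in the clause.
-- A CNF formula with m clauses is an injective map Fin m → Clause nv
-- (injectivity = the clauses form a set of m distinct clauses);
-- clauses are identified with their indices Fin m.

Clause : ℕ → Set
Clause nv = Vec (Maybe Bool) nv

occurs : {nv m : ℕ} → (Fin m → Clause nv) → Fin nv → Bool
occurs {m = m} F v = any (λ c → is-just (lookup (F c) v)) (allFin m)

varF : {nv m : ℕ} → (Fin m → Clause nv) → Subset nv
varF F = tabulate (occurs F)

Vertex : {nv m : ℕ} → (Fin m → Clause nv) → Set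
Vertex {nv} {m} F = (Σ (Fin nv) (λ v → T (occurs F v))) ⊎ Fin m

-- Rooted binary trees whose leaves are labelled (the labelling is δ).

data Tree (A : Set) : Set where
  leaf : A → Tree A
  node : Tree A → Tree A → Tree A

leaves : {A : Set} → Tree A → List A
leaves (leaf a)   = a ∷ []
leaves (node l r) = leaves l ++ leaves r

-- (T , δ) is a decomposition tree of I(F): δ is a bijection from the
-- leaves of T onto the vertex set of I(F), i.e. every vertex labels
-- some leaf and no two leaves carry the same label.
IsDecompTree : {nv m : ℕ} (F : Fin m → Clause nv) → Tree (Vertex F) → Set
IsDecompTree F t = (∀ (u : Vertex F) → u ∈ leaves t) × Unique (leaves t)

-- t is the subtree T_z rooted at some node z of T
data _≼_ {A : Set} : Tree A → Tree A → Set where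
  here  : ∀ {t} → t ≼ t
  left  : ∀ {t l r} → t ≼ l → t ≼ node l r
  right : ∀ {t l r} → t ≼ r → t ≼ node l r

-- An element σ of 2^X (X ⊆ Fin nv) is represented
-- canonically by the vector σ' : Vec Bool nv that agrees with σ on X and
-- is false outside X; 2^X is thus the list of vectors σ' with
-- (σ' as a subset) ⊆ X.

allSubsets : (n : ℕ) → List (Subset n)
allSubsets zero    = [] ∷ []
allSubsets (suc n) = map (false ∷_) (allSubsets n) ++ map (true ∷_) (allSubsets n)

assignments : {nv : ℕ} → Subset nv → List (Vec Bool nv)
assignments {nv} X = filterᵇ (λ σ → ⌊ σ ⊆? X ⌋) (allSubsets nv)

litSat : Bool → Maybe Bool → Bool
litSat b (just p) = ⌊ b BoolP.≟ p ⌋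
litSat b nothing  = false

satisfies : {nv : ℕ} → Subset nv → Vec Bool nv → Clause nv → Bool
satisfies {nv} X σ C =
  any (λ v → lookup X v ∧ litSat (lookup σ v) (lookup C v)) (allFin nv)

Shape : ℕ → Set
Shape m = Subset m × Subset m

allShapes : (m : ℕ) → List (Shape m)
allShapes m = cartesianProduct (allSubsets m) (allSubsets m)

module _ {nv m : ℕ} (F : Fin m → Clause nv) where

  inVar : Tree (Vertex F) → Fin nv → Bool
  inVar (leaf (inj₁ (w , _))) v = ⌊ w Fin.≟ v ⌋
  inVar (leaf (inj₂ _))       v = false
  inVar (node l r)            v = inVar l v ∨ inVar r v

  inCl : Tree (Vertex F) → Fin m → Bool
  inCl (leaf (inj₁ _))  c = false
  inCl (leaf (inj₂ d))  c = ⌊ d Fin.≟ c ⌋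
  inCl (node l r)       c = inCl l c ∨ inCl r c

  varOf : Tree (Vertex F) → Subset nv
  varOf t = tabulate (inVar t)

  coVarOf : Tree (Vertex F) → Subset nv
  coVarOf t = varF F ∩ ∁ (varOf t)

  clOf : Tree (Vertex F) → Subset m
  clOf t = tabulate (inCl t)

  satSet : Subset m → Subset nv → Vec Bool nv → Subset m
  satSet G X σ = tabulate (λ c → lookup G c ∧ satisfies X σ (F c))

  inProj : Subset m → Subset nv → Subset m → Bool
  inProj G X S = any (λ σ → ⌊ ≡-dec BoolP._≟_ (satSet G X σ) S ⌋) (assignments X)


  isShape : Tree (Vertex F) → Shape m → Bool
  isShape t (out , inn) = ⌊ out ⊆? ∁ (clOf t) ⌋ ∧ ⌊ inn ⊆? clOf t ⌋

  ofShape : Tree (Vertex F) → Shape m → Vec Bool nv → Bool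
  ofShape t (out , inn) τ =
    ⌊ ≡-dec BoolP._≟_ (satSet (∁ (clOf t)) (varOf t) τ) out ⌋
    ∧ all (λ c → not (lookup (clOf t) c) ∨ satisfies (varOf t) τ (F c) ∨ lookup inn c) (allFin m)

  nShape : Tree (Vertex F) → Shape m → ℕ
  nShape t s = length (filterᵇ (ofShape t s) (assignments (varOf t)))

  isProper : Tree (Vertex F) → Shape m → Bool
  isProper t (out , inn) =
    inProj (∁ (clOf t)) (varOf t) out ∧ inProj (clOf t) (coVarOf t) inn

  generates : (tx ty : Tree (Vertex F)) →
              Shape m → Shape m → Shape m → Bool
  generates tx ty (outx , inx) (outy , iny) (outz , inz) =
    isShape tx (outx , inx) ∧ isShape ty (outy , iny) ∧
    ⌊ ≡-dec BoolP._≟_ outz ((outx ∪ outy) ∩ ∁ (clOf (node tx ty))) ⌋ ∧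
    ⌊ ≡-dec BoolP._≟_ inx ((inz ∪ outy) ∩ clOf tx) ⌋ ∧
    ⌊ ≡-dec BoolP._≟_ iny ((inz ∪ outx) ∩ clOf ty) ⌋


  properGen : (tx ty : Tree (Vertex F)) →
              Shape m → List (Shape m × Shape m)
  properGen tx ty s =
    filterᵇ (λ p → generates tx ty (proj₁ p) (proj₂ p) s ∧
                   isProper tx (proj₁ p) ∧ isProper ty (proj₂ p))
            (cartesianProduct (allShapes m) (allShapes m))

  sumOverP : (tx ty : Tree (Vertex F)) → Shape m → ℕ
  sumOverP tx ty s = sum (map (λ p → nShape tx (proj₁ p) * nShape ty (proj₂ p)) (properGen tx ty s))

-- The leaves of T carry distinct labels, so var_x and var_y are disjoint and the assignments τ of var_z are exactly the unions a ∪ b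
-- of an assignment a of var_x and an assignment b of var_y.  For fixed a and b the only pair
-- that can generate s with a of shape s_x and b of shape s_y is
--   s_x = (F̄_x(a), (in_z ∪ F̄_y(b)) ∩ F_x),   s_y = (F̄_y(b), (in_z ∪ F̄_x(a)) ∩ F_y),
-- and it does so iff a ∪ b has shape s.  This pair is always proper: its out-parts are
-- projections by definition, and if σ ∈ 2^(var(F) ∖ var_z) witnesses in_z ∈ Proj(F_z, ·),
-- then σ ∪ b witnesses in_x, because var(F) ∖ var_x = (var(F) ∖ var_z) ∪ var_y.
-- Summing the indicator of "a ∪ b has shape s" over a and b gives the formula.
module Submission where

open import Algebra.Bundles using (CommutativeMonoid)
open import Algebra.Properties.CommutativeSemigroup using (interchange)
open import Data.Bool using (Bool; true; false; _∧_; _∨_; not; if_then_else_; T)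
open import Data.Bool.ListAction using (any; or)
open import Data.Bool.Properties using (T-≡; T-∧; T-∨; T-irrelevant; ∨-identityʳ; ∨-comm; ∨-assoc; ∨-commutativeMonoid; ∧-comm; ∧-identityʳ; ∧-zeroʳ)
import Data.Bool.Properties as Bool
open import Data.Empty using (⊥)
open import Data.Fin using (Fin; zero; suc)
open import Data.Fin.Subset using (Subset; _∈_; _∩_; _∪_; ∁)
open import Data.Fin.Subset.Properties using (_⊆?_; p∩q⊆q)
open import Data.List using (List; []; _∷_; map; _++_; filterᵇ; length; cartesianProduct; allFin)
open import Data.List.Membership.Propositional using (find; lose) renaming (_∈_ to _∈ˡ_)
open import Data.List.Membership.Propositional.Properties using (∈-map⁺; ∈-++⁺ˡ; ∈-++⁺ʳ; ∈-allFin; ∈-filter⁺; ∈-filter⁻)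
open import Data.List.Properties using (map-++; map-cong; map-∘)
import Data.List.Relation.Unary.All as All
open import Data.List.Relation.Unary.All.Properties using (all⁺; all⁻; ++⁻ˡ)
open import Data.List.Relation.Unary.AllPairs using ([]; _∷_)
open import Data.List.Relation.Unary.Any using (here; there)
open import Data.List.Relation.Unary.Any.Properties using (any⁺; any⁻)
open import Data.List.Relation.Unary.Unique.Propositional using (Unique)
open import Data.Maybe using (Maybe)
open import Data.Nat using (ℕ; suc; _+_; _*_)
open import Data.Nat.ListAction using (sum)
open import Data.Nat.ListAction.Properties using (sum-++)
open import Data.Nat.Properties using (+-identityʳ; +-commutativeSemigroup; *-zeroʳ; *-identityˡ; *-comm; *-distribˡ-+)
open import Data.Product using (Σ-syntax; _×_; _,_; proj₁; proj₂)
open import Data.Sum using (inj₁; inj₂)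
import Data.Sum as Sum
open import Data.Vec using (Vec; []; _∷_; lookup; tabulate)
open import Data.Vec.Properties using (≡-dec; []=⇒lookup; lookup⇒[]=; lookup∘tabulate; lookup-zipWith; lookup-map; tabulate∘lookup; tabulate-cong)
open import Function using (_∘_; _⇔_; mk⇔; Equivalence)
open import Function.Definitions using (Injective)
open import Relation.Binary.PropositionalEquality using (_≡_; refl; sym; trans; cong; cong₂; subst)
open import Relation.Nullary.Decidable using (⌊_⌋; isYes≗does; toWitness; fromWitness; T?)

open import Defs

open Equivalence using (to; from)
open Relation.Binary.PropositionalEquality.≡-Reasoning

private variable
  A B : Set
  n : ℕ

∑ : List A → (A → ℕ) → ℕ
∑ xs f = sum (map f xs)

guard : Bool → ℕ → ℕ
guard b n = if b then n else 0

iverson : Bool → ℕ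
iverson b = guard b 1

∑-cong : (xs : List A) {f g : A → ℕ} → (∀ x → f x ≡ g x) → ∑ xs f ≡ ∑ xs g
∑-cong xs f≗g = cong sum (map-cong f≗g xs)

∑-++ : (xs ys : List A) (f : A → ℕ) → ∑ (xs ++ ys) f ≡ ∑ xs f + ∑ ys f
∑-++ xs ys f = trans (cong sum (map-++ f xs ys)) (sum-++ (map f xs) (map f ys))

∑-map : (xs : List B) (g : B → A) (f : A → ℕ) → ∑ (map g xs) f ≡ ∑ xs (f ∘ g)
∑-map xs g f = cong sum (sym (map-∘ xs))

∑-+ : (xs : List A) (f g : A → ℕ) → ∑ xs (λ x → f x + g x) ≡ ∑ xs f + ∑ xs g
∑-+ []       f g = refl
∑-+ (x ∷ xs) f g = trans (cong (f x + g x +_) (∑-+ xs f g))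
                      (interchange +-commutativeSemigroup (f x) (g x) (∑ xs f) (∑ xs g))

∑-*ˡ : (xs : List A) (k : ℕ) (f : A → ℕ) → ∑ xs (λ x → k * f x) ≡ k * ∑ xs f
∑-*ˡ []       k f = sym (*-zeroʳ k)
∑-*ˡ (x ∷ xs) k f = trans (cong (k * f x +_) (∑-*ˡ xs k f)) (sym (*-distribˡ-+ k (f x) _))

∑-*ʳ : (xs : List A) (k : ℕ) (f : A → ℕ) → ∑ xs (λ x → f x * k) ≡ ∑ xs f * k
∑-*ʳ xs k f = trans (∑-cong xs (λ x → *-comm (f x) k)) (trans (∑-*ˡ xs k f) (*-comm k _))

∑-zero : (xs : List A) → ∑ xs (λ _ → 0) ≡ 0
∑-zero []       = refl
∑-zero (x ∷ xs) = ∑-zero xs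

∑-guard : (xs : List A) (b : Bool) (f : A → ℕ) → ∑ xs (λ x → guard b (f x)) ≡ guard b (∑ xs f)
∑-guard xs true  f = refl
∑-guard xs false f = ∑-zero xs

∑-filterᵇ : (p : A → Bool) (xs : List A) (f : A → ℕ) → ∑ (filterᵇ p xs) f ≡ ∑ xs (λ x → guard (p x) (f x))
∑-filterᵇ p []       f = refl
∑-filterᵇ p (x ∷ xs) f with p x
... | true  = cong (f x +_) (∑-filterᵇ p xs f)
... | false = ∑-filterᵇ p xs f

length-filterᵇ : (p : A → Bool) (xs : List A) → length (filterᵇ p xs) ≡ ∑ xs (iverson ∘ p)
length-filterᵇ p []       = refl
length-filterᵇ p (x ∷ xs) with p x
... | true  = cong suc (length-filterᵇ p xs)
... | false = length-filterᵇ p xs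

∑-comm : (xs : List A) (ys : List B) (f : A → B → ℕ) →
         ∑ xs (λ x → ∑ ys (f x)) ≡ ∑ ys (λ y → ∑ xs (λ x → f x y))
∑-comm []       ys f = sym (∑-zero ys)
∑-comm (x ∷ xs) ys f = trans (cong (∑ ys (f x) +_) (∑-comm xs ys f))
                             (sym (∑-+ ys (f x) (λ y → ∑ xs (λ x → f x y))))

∑-cartesianProduct : (xs : List A) (ys : List B) (f : A × B → ℕ) →
                     ∑ (cartesianProduct xs ys) f ≡ ∑ xs (λ x → ∑ ys (λ y → f (x , y)))
∑-cartesianProduct []       ys f = refl
∑-cartesianProduct (x ∷ xs) ys f =
  trans (∑-++ (map (x ,_) ys) _ f)
        (cong₂ _+_ (∑-map ys (x ,_) f) (∑-cartesianProduct xs ys f))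

∑-*-∑ : (xs : List A) (ys : List B) (f : A → ℕ) (g : B → ℕ) →
        ∑ xs f * ∑ ys g ≡ ∑ xs (λ x → ∑ ys (λ y → f x * g y))
∑-*-∑ xs ys f g = sym (trans (∑-cong xs (λ x → ∑-*ˡ ys (f x) g)) (∑-*ʳ xs (∑ ys g) f))

guard-∧ : (a b : Bool) (n : ℕ) → guard (a ∧ b) n ≡ guard a (guard b n)
guard-∧ true  b n = refl
guard-∧ false b n = refl

guard-+ : (b : Bool) (m n : ℕ) → guard b (m + n) ≡ guard b m + guard b n
guard-+ true  m n = refl
guard-+ false m n = refl

guard≡iverson-* : (b : Bool) (n : ℕ) → guard b n ≡ iverson b * n
guard≡iverson-* true  n = sym (*-identityˡ n)
guard≡iverson-* false n = refl

iverson-∧ : (a b : Bool) → iverson (a ∧ b) ≡ iverson a * iverson b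
iverson-∧ true  b = sym (*-identityˡ (iverson b))
iverson-∧ false b = refl

guard-comm : (a b : Bool) (n : ℕ) → guard a (guard b n) ≡ guard b (guard a n)
guard-comm true  b     n = refl
guard-comm false true  n = refl
guard-comm false false n = refl

guard-*-guard : (a b : Bool) (m n : ℕ) → guard a m * guard b n ≡ guard a (guard b (m * n))
guard-*-guard true  true  m n = refl
guard-*-guard true  false m n = *-zeroʳ m
guard-*-guard false b     m n = refl

∑-cartesianProduct-iverson : (xs : List A) (ys : List B) (f : A → Bool) (g : B → Bool) →
  ∑ xs (iverson ∘ f) ≡ 1 → ∑ ys (iverson ∘ g) ≡ 1 →
  ∑ (cartesianProduct xs ys) (λ p → iverson (f (proj₁ p) ∧ g (proj₂ p))) ≡ 1
∑-cartesianProduct-iverson xs ys f g ∑f≡1 ∑g≡1 = begin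
    ∑ (cartesianProduct xs ys) (λ p → iverson (f (proj₁ p) ∧ g (proj₂ p)))
  ≡⟨ ∑-cartesianProduct xs ys _ ⟩
    ∑ xs (λ x → ∑ ys (λ y → iverson (f x ∧ g y)))
  ≡⟨ ∑-cong xs (λ x → ∑-cong ys (λ y → iverson-∧ (f x) (g y))) ⟩
    ∑ xs (λ x → ∑ ys (λ y → iverson (f x) * iverson (g y)))
  ≡⟨ sym (∑-*-∑ xs ys (iverson ∘ f) (iverson ∘ g)) ⟩
    ∑ xs (iverson ∘ f) * ∑ ys (iverson ∘ g)
  ≡⟨ cong₂ _*_ ∑f≡1 ∑g≡1 ⟩
    1
  ∎

T-injective : {a b : Bool} → (T a → T b) → (T b → T a) → a ≡ b
T-injective {false} {false} _ _ = refl
T-injective {false} {true}  _ g with () ← g _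
T-injective {true}  {false} f _ with () ← f _
T-injective {true}  {true}  _ _ = refl

∈⇔T-lookup : {i : Fin n} {p : Subset n} → i ∈ p ⇔ T (lookup p i)
∈⇔T-lookup {i = i} {p} = mk⇔ (from T-≡ ∘ []=⇒lookup) (lookup⇒[]= i p ∘ to T-≡)

infix 4 _≐_
_≐_ : Subset n → Subset n → Bool
u ≐ w = ⌊ ≡-dec Bool._≟_ u w ⌋

≐⇔≡ : {u w : Subset n} → T (u ≐ w) ⇔ u ≡ w
≐⇔≡ {u = u} {w} = mk⇔ toWitness (fromWitness {a? = ≡-dec Bool._≟_ u w})

-- ⌊_⌋ does not compute through Dec.map′ while does does, hence the detour through isYes≗does.
∷-≐-∷ : (a b : Bool) (u w : Subset n) → ((a ∷ u) ≐ (b ∷ w)) ≡ ⌊ a Bool.≟ b ⌋ ∧ (u ≐ w)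
∷-≐-∷ false false u w = trans (isYes≗does _) (sym (isYes≗does _))
∷-≐-∷ true  true  u w = trans (isYes≗does _) (sym (isYes≗does _))
∷-≐-∷ false true  u w = isYes≗does (≡-dec Bool._≟_ (false ∷ u) (true ∷ w))
∷-≐-∷ true  false u w = isYes≗does (≡-dec Bool._≟_ (true ∷ u) (false ∷ w))

∷-⊆?-∷ : (a b : Bool) (u w : Subset n) → ⌊ (a ∷ u) ⊆? (b ∷ w) ⌋ ≡ (not a ∨ b) ∧ ⌊ u ⊆? w ⌋
∷-⊆?-∷ false false u w = trans (isYes≗does _) (sym (isYes≗does _))
∷-⊆?-∷ false true  u w = trans (isYes≗does _) (sym (isYes≗does _))
∷-⊆?-∷ true  true  u w = trans (isYes≗does _) (sym (isYes≗does _))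
∷-⊆?-∷ true  false u w = refl

∈-allSubsets : (σ : Subset n) → σ ∈ˡ allSubsets n
∈-allSubsets []          = here refl
∈-allSubsets {suc n} (false ∷ σ) = ∈-++⁺ˡ (∈-map⁺ (false ∷_) (∈-allSubsets σ))
∈-allSubsets {suc n} (true  ∷ σ) = ∈-++⁺ʳ (map (false ∷_) (allSubsets n)) (∈-map⁺ (true ∷_) (∈-allSubsets σ))

∑-allSubsets-suc : (f : Subset (suc n) → ℕ) →
  ∑ (allSubsets (suc n)) f ≡ ∑ (allSubsets n) (f ∘ (false ∷_)) + ∑ (allSubsets n) (f ∘ (true ∷_))
∑-allSubsets-suc {n} f =
  trans (∑-++ (map (false ∷_) (allSubsets n)) _ f)
        (cong₂ _+_ (∑-map (allSubsets n) _ f) (∑-map (allSubsets n) _ f))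

∑-allSubsets-≐ : (u₀ : Subset n) → ∑ (allSubsets n) (λ u → iverson (u ≐ u₀)) ≡ 1
∑-allSubsets-≐ [] = refl
∑-allSubsets-≐ {suc n} (b ∷ u₀) = begin
    ∑ (allSubsets (suc n)) (λ u → iverson (u ≐ (b ∷ u₀)))
  ≡⟨ ∑-allSubsets-suc {n} (λ u → iverson (u ≐ (b ∷ u₀))) ⟩
    ∑ 𝒮 (λ u → iverson ((false ∷ u) ≐ (b ∷ u₀))) + ∑ 𝒮 (λ u → iverson ((true ∷ u) ≐ (b ∷ u₀)))
  ≡⟨ cong₂ _+_ (∑-cong 𝒮 (λ u → cong iverson (∷-≐-∷ false b u u₀)))
               (∑-cong 𝒮 (λ u → cong iverson (∷-≐-∷ true b u u₀))) ⟩
    ∑ 𝒮 (λ u → iverson (⌊ false Bool.≟ b ⌋ ∧ (u ≐ u₀)))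
      + ∑ 𝒮 (λ u → iverson (⌊ true Bool.≟ b ⌋ ∧ (u ≐ u₀)))
  ≡⟨ heads b ⟩
    1
  ∎
  where
  𝒮 = allSubsets n
  heads : (b : Bool) →
    ∑ 𝒮 (λ u → iverson (⌊ false Bool.≟ b ⌋ ∧ (u ≐ u₀)))
      + ∑ 𝒮 (λ u → iverson (⌊ true Bool.≟ b ⌋ ∧ (u ≐ u₀))) ≡ 1
  heads false = cong₂ _+_ (∑-allSubsets-≐ u₀) (∑-zero 𝒮)
  heads true  = cong₂ _+_ (∑-zero 𝒮) (∑-allSubsets-≐ u₀)

Disjoint : Subset n → Subset n → Set
Disjoint p q = ∀ i → T (lookup p i ∧ lookup q i) → ⊥

⊆?⇒lookup : {p q : Subset n} → T ⌊ p ⊆? q ⌋ → ∀ i → T (lookup p i) → T (lookup q i)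
⊆?⇒lookup p⊆q i = to ∈⇔T-lookup ∘ toWitness p⊆q ∘ from ∈⇔T-lookup

lookup⇒⊆? : {p q : Subset n} → (∀ i → T (lookup p i) → T (lookup q i)) → T ⌊ p ⊆? q ⌋
lookup⇒⊆? p⊑q = fromWitness (λ {i} → from ∈⇔T-lookup ∘ p⊑q i ∘ to ∈⇔T-lookup)

∑⊆ : Subset n → (Subset n → ℕ) → ℕ
∑⊆ {n} X f = ∑ (allSubsets n) (λ τ → guard ⌊ τ ⊆? X ⌋ (f τ))

∑⊆-cong : (X : Subset n) {f g : Subset n → ℕ} → (∀ τ → T ⌊ τ ⊆? X ⌋ → f τ ≡ g τ) → ∑⊆ X f ≡ ∑⊆ X g
∑⊆-cong {n} X {f} {g} f≗g = ∑-cong (allSubsets n) pointwise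
  where
  pointwise : ∀ τ → guard ⌊ τ ⊆? X ⌋ (f τ) ≡ guard ⌊ τ ⊆? X ⌋ (g τ)
  pointwise τ with ⌊ τ ⊆? X ⌋ in τ⊆X
  ... | true  = f≗g τ (subst T (sym τ⊆X) _)
  ... | false = refl

∑⊆-+ : (X : Subset n) (f g : Subset n → ℕ) → ∑⊆ X (λ τ → f τ + g τ) ≡ ∑⊆ X f + ∑⊆ X g
∑⊆-+ {n} X f g = trans (∑-cong (allSubsets n) (λ τ → guard-+ ⌊ τ ⊆? X ⌋ (f τ) (g τ))) (∑-+ (allSubsets n) _ _)

∑⊆-∷ : (x : Bool) (X : Subset n) (f : Subset (suc n) → ℕ) →
  ∑⊆ (x ∷ X) f ≡ ∑⊆ X (f ∘ (false ∷_)) + guard x (∑⊆ X (f ∘ (true ∷_)))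
∑⊆-∷ {n} x X f = begin
    ∑⊆ (x ∷ X) f
  ≡⟨ ∑-allSubsets-suc {n} (λ τ → guard ⌊ τ ⊆? (x ∷ X) ⌋ (f τ)) ⟩
    ∑ 𝒮 (λ τ → guard ⌊ (false ∷ τ) ⊆? (x ∷ X) ⌋ _) + ∑ 𝒮 (λ τ → guard ⌊ (true ∷ τ) ⊆? (x ∷ X) ⌋ _)
  ≡⟨ cong₂ _+_ (∑-cong 𝒮 (λ τ → cong (λ b → guard b _) (∷-⊆?-∷ false x τ X)))
               (∑-cong 𝒮 (λ τ → trans (cong (λ b → guard b _) (∷-⊆?-∷ true x τ X)) (guard-∧ x _ _))) ⟩
    ∑⊆ X (f ∘ (false ∷_)) + ∑ 𝒮 (λ τ → guard x (guard ⌊ τ ⊆? X ⌋ (f (true ∷ τ))))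
  ≡⟨ cong (∑⊆ X (f ∘ (false ∷_)) +_) (∑-guard 𝒮 x _) ⟩
    ∑⊆ X (f ∘ (false ∷_)) + guard x (∑⊆ X (f ∘ (true ∷_)))
  ∎
  where 𝒮 = allSubsets n

∑⊆-∪ : (X Y : Subset n) → Disjoint X Y → (f : Subset n → ℕ) →
  ∑⊆ (X ∪ Y) f ≡ ∑⊆ X (λ a → ∑⊆ Y (λ b → f (a ∪ b)))
∑⊆-∪ [] [] _ f = cong (_+ 0) (sym (+-identityʳ (f [])))
∑⊆-∪ (x ∷ X) (y ∷ Y) disjoint f = begin
    ∑⊆ ((x ∨ y) ∷ (X ∪ Y)) f
  ≡⟨ ∑⊆-∷ (x ∨ y) (X ∪ Y) f ⟩
    ∑⊆ (X ∪ Y) (f ∘ (false ∷_)) + guard (x ∨ y) (∑⊆ (X ∪ Y) (f ∘ (true ∷_)))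
  ≡⟨ cong₂ (λ l r → l + guard (x ∨ y) r) (IH false) (IH true) ⟩
    ∑⊆ X (G false) + guard (x ∨ y) (∑⊆ X (G true))
  ≡⟨ heads x y (disjoint zero) ⟩
    ∑⊆ X (λ a → G false a + guard y (G (false ∨ true) a))
      + guard x (∑⊆ X (λ a → G (true ∨ false) a + guard y (G true a)))
  ≡⟨ sym (cong₂ (λ l r → l + guard x r) (∑⊆-cong X (λ a _ → inner false a)) (∑⊆-cong X (λ a _ → inner true a))) ⟩
    ∑⊆ X (λ a → ∑⊆ (y ∷ Y) (λ b → f ((false ∷ a) ∪ b)))
      + guard x (∑⊆ X (λ a → ∑⊆ (y ∷ Y) (λ b → f ((true ∷ a) ∪ b))))
  ≡⟨ sym (∑⊆-∷ x X _) ⟩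
    ∑⊆ (x ∷ X) (λ a → ∑⊆ (y ∷ Y) (λ b → f (a ∪ b)))
  ∎
  where
  G : Bool → Subset _ → ℕ
  G h a = ∑⊆ Y (λ b → f (h ∷ (a ∪ b)))
  IH : (h : Bool) → ∑⊆ (X ∪ Y) (f ∘ (h ∷_)) ≡ ∑⊆ X (G h)
  IH h = ∑⊆-∪ X Y (disjoint ∘ suc) (f ∘ (h ∷_))
  inner : (h : Bool) (a : Subset _) → ∑⊆ (y ∷ Y) (λ b → f ((h ∷ a) ∪ b)) ≡ G (h ∨ false) a + guard y (G (h ∨ true) a)
  inner h a = ∑⊆-∷ y Y (λ b → f ((h ∷ a) ∪ b))
  heads : (x y : Bool) → (T (x ∧ y) → ⊥) →
    ∑⊆ X (G false) + guard (x ∨ y) (∑⊆ X (G true)) ≡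
    ∑⊆ X (λ a → G false a + guard y (G (false ∨ true) a))
      + guard x (∑⊆ X (λ a → G (true ∨ false) a + guard y (G true a)))
  heads false false _ = cong (_+ 0) (sym (∑⊆-cong X (λ a _ → +-identityʳ (G false a))))
  heads true  false _ =
    sym (cong₂ _+_ (∑⊆-cong X (λ a _ → +-identityʳ (G false a))) (∑⊆-cong X (λ a _ → +-identityʳ (G true a))))
  heads false true  _ = trans (sym (∑⊆-+ X (G false) (G true))) (sym (+-identityʳ _))
  heads true  true  x∧y with () ← x∧y _

∑⊆-guard : (X : Subset n) (b : Bool) (f : Subset n → ℕ) → ∑⊆ X (λ τ → guard b (f τ)) ≡ guard b (∑⊆ X f)
∑⊆-guard {n} X b f = trans (∑-cong (allSubsets n) (λ τ → guard-comm ⌊ τ ⊆? X ⌋ b (f τ))) (∑-guard (allSubsets n) b _)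

∑⊆-comm-∑ : (X : Subset n) (xs : List A) (f : Subset n → A → ℕ) →
  ∑⊆ X (λ τ → ∑ xs (f τ)) ≡ ∑ xs (λ x → ∑⊆ X (λ τ → f τ x))
∑⊆-comm-∑ {n} X xs f =
  trans (∑-cong (allSubsets n) (λ τ → sym (∑-guard xs ⌊ τ ⊆? X ⌋ (f τ)))) (∑-comm (allSubsets n) xs _)

∑⊆-*-∑⊆ : (X Y : Subset n) (f g : Subset n → ℕ) →
          ∑⊆ X f * ∑⊆ Y g ≡ ∑⊆ X (λ a → ∑⊆ Y (λ b → f a * g b))
∑⊆-*-∑⊆ {n} X Y f g = trans (∑-*-∑ (allSubsets n) (allSubsets n) _ _)
  (∑-cong (allSubsets n) (λ a → trans (∑-cong (allSubsets n) (λ b → guard-*-guard ⌊ a ⊆? X ⌋ ⌊ b ⊆? Y ⌋ (f a) (g b)))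
                                      (∑-guard (allSubsets n) ⌊ a ⊆? X ⌋ _)))

lookup-injective : (u w : Vec A n) → (∀ i → lookup u i ≡ lookup w i) → u ≡ w
lookup-injective u w u≗w = trans (sym (tabulate∘lookup u)) (trans (tabulate-cong u≗w) (tabulate∘lookup w))

lookup-∪ : (p q : Subset n) (i : Fin n) → lookup (p ∪ q) i ≡ lookup p i ∨ lookup q i
lookup-∪ p q i = lookup-zipWith _∨_ i p q

lookup-∩ : (p q : Subset n) (i : Fin n) → lookup (p ∩ q) i ≡ lookup p i ∧ lookup q i
lookup-∩ p q i = lookup-zipWith _∧_ i p q

lookup-∁ : (p : Subset n) (i : Fin n) → lookup (∁ p) i ≡ not (lookup p i)
lookup-∁ p i = lookup-map i not p

∪-mono-⊆? : {p p′ q q′ : Subset n} → T ⌊ p ⊆? p′ ⌋ → T ⌊ q ⊆? q′ ⌋ → T ⌊ (p ∪ q) ⊆? (p′ ∪ q′) ⌋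
∪-mono-⊆? {p = p} {p′} {q} {q′} p⊆p′ q⊆q′ = lookup⇒⊆? λ i i∈ →
  subst T (sym (lookup-∪ p′ q′ i))
    (from (T-∨ {lookup p′ i}) (Sum.map (⊆?⇒lookup p⊆p′ i) (⊆?⇒lookup q⊆q′ i)
      (to (T-∨ {lookup p i}) (subst T (lookup-∪ p q i) i∈))))

satSet⊆ : {nv m : ℕ} (F : Fin m → Clause nv) (G : Subset m) (X τ : Subset nv) → T ⌊ satSet F G X τ ⊆? G ⌋
satSet⊆ F G X τ = lookup⇒⊆? λ c c∈ → proj₁ (to T-∧ (subst T (lookup∘tabulate _ c) c∈))

any-∨ : (f g : A → Bool) (xs : List A) → any (λ x → f x ∨ g x) xs ≡ any f xs ∨ any g xs
any-∨ f g []       = refl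
any-∨ f g (x ∷ xs) =
  trans (cong ((f x ∨ g x) ∨_) (any-∨ f g xs))
        (interchange (CommutativeMonoid.commutativeSemigroup ∨-commutativeMonoid) (f x) (g x) _ _)

-- With disjoint domains every literal of C is evaluated by exactly one of σ and ρ.
satisfies-∪ : {nv : ℕ} (U V : Subset nv) → Disjoint U V → (σ ρ : Subset nv) →
  T ⌊ σ ⊆? U ⌋ → T ⌊ ρ ⊆? V ⌋ → (C : Clause nv) →
  satisfies (U ∪ V) (σ ∪ ρ) C ≡ satisfies U σ C ∨ satisfies V ρ C
satisfies-∪ {nv} U V U#V σ ρ σ⊆U ρ⊆V C =
  trans (cong or (map-cong literal (allFin nv))) (any-∨ _ _ (allFin nv))
  where
  split : (u w s r : Bool) (l : Maybe Bool) → (T (u ∧ w) → ⊥) → (T s → T u) → (T r → T w) →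
          (u ∨ w) ∧ litSat (s ∨ r) l ≡ (u ∧ litSat s l) ∨ (w ∧ litSat r l)
  split true  true  _     _     _ u#w _   _   with () ← u#w _
  split true  false s     false l _   _   _   = trans (cong (λ b → litSat b l) (∨-identityʳ s)) (sym (∨-identityʳ _))
  split true  false _     true  _ _   _   r⇒w with () ← r⇒w _
  split false true  false r     l _   _   _   = refl
  split false true  true  _     _ _   s⇒u _   with () ← s⇒u _
  split false false _     _     _ _   _   _   = refl
  literal : ∀ v → lookup (U ∪ V) v ∧ litSat (lookup (σ ∪ ρ) v) (lookup C v)
                ≡ (lookup U v ∧ litSat (lookup σ v) (lookup C v)) ∨ (lookup V v ∧ litSat (lookup ρ v) (lookup C v))
  literal v = trans (cong₂ (λ u s → u ∧ litSat s (lookup C v)) (lookup-∪ U V v) (lookup-∪ σ ρ v))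
                    (split _ _ _ _ (lookup C v) (U#V v) (⊆?⇒lookup σ⊆U v) (⊆?⇒lookup ρ⊆V v))

Unique-++⁻ˡ : (xs ys : List A) → Unique (xs ++ ys) → Unique xs
Unique-++⁻ˡ []       ys _           = []
Unique-++⁻ˡ (x ∷ xs) ys (x∉ ∷ uniq) = ++⁻ˡ xs x∉ ∷ Unique-++⁻ˡ xs ys uniq

Unique-++⁻ʳ : (xs ys : List A) → Unique (xs ++ ys) → Unique ys
Unique-++⁻ʳ []       ys uniq       = uniq
Unique-++⁻ʳ (x ∷ xs) ys (_ ∷ uniq) = Unique-++⁻ʳ xs ys uniq

Unique-++⇒∉ : (xs ys : List A) {u : A} → Unique (xs ++ ys) → u ∈ˡ xs → u ∈ˡ ys → ⊥
Unique-++⇒∉ (x ∷ xs) ys (x∉ ∷ _)    (here refl) u∈ys = All.lookup x∉ (∈-++⁺ʳ xs u∈ys) refl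
Unique-++⇒∉ (x ∷ xs) ys (_  ∷ uniq) (there u∈xs) u∈ys = Unique-++⇒∉ xs ys uniq u∈xs u∈ys

Unique-≼ : {t t₀ : Tree A} → t ≼ t₀ → Unique (leaves t₀) → Unique (leaves t)
Unique-≼ here uniq = uniq
Unique-≼ {t₀ = node l r} (left  t≼l) uniq = Unique-≼ t≼l (Unique-++⁻ˡ (leaves l) (leaves r) uniq)
Unique-≼ {t₀ = node l r} (right t≼r) uniq = Unique-≼ t≼r (Unique-++⁻ʳ (leaves l) (leaves r) uniq)

module _ {nv m : ℕ} (F : Fin m → Clause nv) where

  inVar⇒∈leaves : (t : Tree (Vertex F)) {v : Fin nv} → T (inVar F t v) →
                  Σ[ p ∈ T (occurs F v) ] inj₁ (v , p) ∈ˡ leaves t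
  inVar⇒∈leaves (leaf (inj₁ (w , p))) w≡v with refl ← toWitness w≡v = p , here refl
  inVar⇒∈leaves (node l r) {v} v∈ with to T-∨ v∈
  ... | inj₁ v∈l = let p , ∈l = inVar⇒∈leaves l v∈l in p , ∈-++⁺ˡ ∈l
  ... | inj₂ v∈r = let p , ∈r = inVar⇒∈leaves r v∈r in p , ∈-++⁺ʳ (leaves l) ∈r

  inCl⇒∈leaves : (t : Tree (Vertex F)) {c : Fin m} → T (inCl F t c) → inj₂ c ∈ˡ leaves t
  inCl⇒∈leaves (leaf (inj₂ d)) d≡c with refl ← toWitness d≡c = here refl
  inCl⇒∈leaves (node l r) {c} c∈ with to T-∨ c∈
  ... | inj₁ c∈l = ∈-++⁺ˡ (inCl⇒∈leaves l c∈l)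
  ... | inj₂ c∈r = ∈-++⁺ʳ (leaves l) (inCl⇒∈leaves r c∈r)

  varOf⊆varF : (t : Tree (Vertex F)) (v : Fin nv) → T (lookup (varOf F t) v) → T (lookup (varF F) v)
  varOf⊆varF t v v∈t = subst T (sym (lookup∘tabulate (occurs F) v))
                         (proj₁ (inVar⇒∈leaves t (subst T (lookup∘tabulate (inVar F t) v) v∈t)))

  varOf-disjoint : (l r : Tree (Vertex F)) → Unique (leaves l ++ leaves r) → Disjoint (varOf F l) (varOf F r)
  varOf-disjoint l r uniq v v∈l∩r
    with p , ∈l ← inVar⇒∈leaves l (subst T (lookup∘tabulate _ v) (proj₁ (to T-∧ v∈l∩r)))
       | q , ∈r ← inVar⇒∈leaves r (subst T (lookup∘tabulate _ v) (proj₂ (to T-∧ v∈l∩r)))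
    with refl ← T-irrelevant p q
    = Unique-++⇒∉ (leaves l) (leaves r) uniq ∈l ∈r

  clOf-disjoint : (l r : Tree (Vertex F)) → Unique (leaves l ++ leaves r) → Disjoint (clOf F l) (clOf F r)
  clOf-disjoint l r uniq c c∈l∩r =
    Unique-++⇒∉ (leaves l) (leaves r) uniq
      (inCl⇒∈leaves l (subst T (lookup∘tabulate _ c) (proj₁ (to T-∧ c∈l∩r))))
      (inCl⇒∈leaves r (subst T (lookup∘tabulate _ c) (proj₂ (to T-∧ c∈l∩r))))

infix 4 _≐ˢ_ _≐ᵖ_
_≐ˢ_ : Shape n → Shape n → Bool
s ≐ˢ s′ = (proj₁ s ≐ proj₁ s′) ∧ (proj₂ s ≐ proj₂ s′)

_≐ᵖ_ : Shape n × Shape n → Shape n × Shape n → Bool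
p ≐ᵖ p′ = (proj₁ p ≐ˢ proj₁ p′) ∧ (proj₂ p ≐ˢ proj₂ p′)

≐ᵖ⇔≡ : {p p′ : Shape n × Shape n} → T (p ≐ᵖ p′) ⇔ p ≡ p′
≐ᵖ⇔≡ {p′ = p′} = mk⇔ sound (λ { refl → complete p′ })
  where
  sound : ∀ {p p′} → T (p ≐ᵖ p′) → p ≡ p′
  sound eq with l , r ← to T-∧ eq with lo , li ← to T-∧ l | ro , ri ← to T-∧ r
    = cong₂ _,_ (cong₂ _,_ (to ≐⇔≡ lo) (to ≐⇔≡ li)) (cong₂ _,_ (to ≐⇔≡ ro) (to ≐⇔≡ ri))
  complete : ∀ p → T (p ≐ᵖ p)
  complete (s , s′) = from (T-∧ {s ≐ˢ s}) (≐ˢ-refl s , ≐ˢ-refl s′)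
    where
    ≐ˢ-refl : ∀ s → T (s ≐ˢ s)
    ≐ˢ-refl (o , i) = from (T-∧ {o ≐ o}) (from ≐⇔≡ refl , from ≐⇔≡ refl)

∑-allShapePairs-≐ᵖ : {m : ℕ} (p₀ : Shape m × Shape m) →
  ∑ (cartesianProduct (allShapes m) (allShapes m)) (λ p → iverson (p ≐ᵖ p₀)) ≡ 1
∑-allShapePairs-≐ᵖ {m} ((o , i) , (o′ , i′)) =
  ∑-cartesianProduct-iverson (allShapes m) (allShapes m) (_≐ˢ (o , i)) (_≐ˢ (o′ , i′))
    (∑-allShapes (o , i)) (∑-allShapes (o′ , i′))
  where
  ∑-allShapes : (s₀ : Shape m) → ∑ (allShapes m) (λ s → iverson (s ≐ˢ s₀)) ≡ 1
  ∑-allShapes (o , i) =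
    ∑-cartesianProduct-iverson (allSubsets m) (allSubsets m) (_≐ o) (_≐ i) (∑-allSubsets-≐ o) (∑-allSubsets-≐ i)

module _ {nv m : ℕ} (F : Fin m → Clause nv) where

  outOf : Tree (Vertex F) → Subset nv → Subset m
  outOf t τ = satSet F (∁ (clOf F t)) (varOf F t) τ

  nShape≡∑⊆ : (t : Tree (Vertex F)) (s : Shape m) → nShape F t s ≡ ∑⊆ (varOf F t) (iverson ∘ ofShape F t s)
  nShape≡∑⊆ t s = trans (length-filterᵇ _ (assignments (varOf F t))) (∑-filterᵇ _ (allSubsets nv) _)

  lookup-satSet : (G : Subset m) (X τ : Subset nv) (c : Fin m) →
                  lookup (satSet F G X τ) c ≡ lookup G c ∧ satisfies X τ (F c)
  lookup-satSet G X τ c = lookup∘tabulate _ c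

  lookup-outOf : (t : Tree (Vertex F)) (τ : Subset nv) (c : Fin m) →
                 lookup (outOf t τ) c ≡ not (lookup (clOf F t) c) ∧ satisfies (varOf F t) τ (F c)
  lookup-outOf t τ c = trans (lookup-satSet (∁ (clOf F t)) (varOf F t) τ c)
                             (cong (_∧ satisfies (varOf F t) τ (F c)) (lookup-∁ (clOf F t) c))

  Covers : Tree (Vertex F) → Subset m → Subset nv → Set
  Covers t inn τ = ∀ c → T (not (lookup (clOf F t) c) ∨ satisfies (varOf F t) τ (F c) ∨ lookup inn c)

  ofShape⇔ : {t : Tree (Vertex F)} {out inn : Subset m} {τ : Subset nv} →
             T (ofShape F t (out , inn) τ) ⇔ (outOf t τ ≡ out × Covers t inn τ)
  ofShape⇔ {t} {out} {inn} {τ} = mk⇔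
    (λ h → let out-eq , covers = to (T-∧ {outOf t τ ≐ out}) h
           in to ≐⇔≡ out-eq , λ c → All.lookup (all⁺ _ (allFin m) covers) (∈-allFin c))
    (λ (out-eq , covers) →
      from (T-∧ {outOf t τ ≐ out}) (from ≐⇔≡ out-eq , all⁻ _ {allFin m} (All.tabulate (λ {c} _ → covers c))))

  record Generates (tx ty : Tree (Vertex F)) (sx sy sz : Shape m) : Set where
    field
      left-isShape  : T (isShape F tx sx)
      right-isShape : T (isShape F ty sy)
      out-node      : proj₁ sz ≡ (proj₁ sx ∪ proj₁ sy) ∩ ∁ (clOf F (node tx ty))
      in-left       : proj₂ sx ≡ (proj₂ sz ∪ proj₁ sy) ∩ clOf F tx
      in-right      : proj₂ sy ≡ (proj₂ sz ∪ proj₁ sx) ∩ clOf F ty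

  generates⇔ : {tx ty : Tree (Vertex F)} {sx sy sz : Shape m} →
               T (generates F tx ty sx sy sz) ⇔ Generates tx ty sx sy sz
  generates⇔ {tx} {ty} {ox , ix} {oy , iy} {oz , iz} = mk⇔
    (λ h → let shx , h′ = to (T-∧ {isShape F tx (ox , ix)}) h
               shy , h″ = to (T-∧ {isShape F ty (oy , iy)}) h′
               e-out , e-in = to (T-∧ {oz ≐ (ox ∪ oy) ∩ ∁ (clOf F (node tx ty))}) h″
               e-inx , e-iny = to (T-∧ {ix ≐ (iz ∪ oy) ∩ clOf F tx}) e-in
           in record { left-isShape = shx ; right-isShape = shy ; out-node = to ≐⇔≡ e-out
                     ; in-left = to ≐⇔≡ e-inx ; in-right = to ≐⇔≡ e-iny })
    (λ g → let open Generates g in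
      from (T-∧ {isShape F tx (ox , ix)}) (left-isShape ,
      from (T-∧ {isShape F ty (oy , iy)}) (right-isShape ,
      from (T-∧ {oz ≐ (ox ∪ oy) ∩ ∁ (clOf F (node tx ty))}) (from ≐⇔≡ out-node ,
      from (T-∧ {ix ≐ (iz ∪ oy) ∩ clOf F tx}) (from ≐⇔≡ in-left , from ≐⇔≡ in-right)))))

  inProj⇔ : {G : Subset m} {X : Subset nv} {S : Subset m} →
            T (inProj F G X S) ⇔ (Σ[ σ ∈ Subset nv ] T ⌊ σ ⊆? X ⌋ × satSet F G X σ ≡ S)
  inProj⇔ {G} {X} {S} = mk⇔
    (λ h → let σ , σ∈ , eq = find (any⁻ (λ τ → satSet F G X τ ≐ S) (assignments X) h)
           in σ , proj₂ (∈-filter⁻ (T? ∘ (λ τ → ⌊ τ ⊆? X ⌋)) {xs = allSubsets nv} σ∈) , to ≐⇔≡ eq)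
    (λ (σ , σ⊆X , eq) → any⁺ (λ τ → satSet F G X τ ≐ S)
      (lose (∈-filter⁺ (T? ∘ (λ τ → ⌊ τ ⊆? X ⌋)) (∈-allSubsets σ) σ⊆X) (from ≐⇔≡ eq)))

-- Bits of a clause c: cx, cy for c ∈ F_x, c ∈ F_y, and sa, sb for "a, resp. b, satisfies c".
out-bits : (cx cy sa sb : Bool) → not (cx ∨ cy) ∧ (sa ∨ sb) ≡ ((not cx ∧ sa) ∨ (not cy ∧ sb)) ∧ not (cx ∨ cy)
out-bits false false sa sb = sym (∧-identityʳ (sa ∨ sb))
out-bits false true  sa sb = sym (∧-zeroʳ _)
out-bits true  _     sa sb = sym (∧-zeroʳ _)

covers-bits : (cx cy sa sb i : Bool) → (T (cx ∧ cy) → ⊥) →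
  (not cx ∨ sa ∨ ((i ∨ (not cy ∧ sb)) ∧ cx)) ∧ (not cy ∨ sb ∨ ((i ∨ (not cx ∧ sa)) ∧ cy))
  ≡ not (cx ∨ cy) ∨ (sa ∨ sb) ∨ i
covers-bits false false sa sb i _ = refl
covers-bits true  true  sa sb i cx#cy with () ← cx#cy _
covers-bits true  false sa sb i _ = begin
    (sa ∨ ((i ∨ sb) ∧ true)) ∧ true  ≡⟨ ∧-identityʳ _ ⟩
    sa ∨ ((i ∨ sb) ∧ true)           ≡⟨ cong (sa ∨_) (trans (∧-identityʳ _) (∨-comm i sb)) ⟩
    sa ∨ (sb ∨ i)                    ≡⟨ sym (∨-assoc sa sb i) ⟩
    (sa ∨ sb) ∨ i                    ∎
covers-bits false true  sa sb i _ = begin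
    sb ∨ ((i ∨ sa) ∧ true)           ≡⟨ cong (sb ∨_) (trans (∧-identityʳ _) (∨-comm i sa)) ⟩
    sb ∨ (sa ∨ i)                    ≡⟨ sym (∨-assoc sb sa i) ⟩
    (sb ∨ sa) ∨ i                    ≡⟨ cong (_∨ i) (∨-comm sb sa) ⟩
    (sa ∨ sb) ∨ i                    ∎

in-bits : (cx cy s sb : Bool) → (T (cx ∧ cy) → ⊥) → cx ∧ (s ∨ sb) ≡ (((cx ∨ cy) ∧ s) ∨ (not cy ∧ sb)) ∧ cx
in-bits false cy    s sb _ = sym (∧-zeroʳ _)
in-bits true  true  s sb cx#cy with () ← cx#cy _
in-bits true  false s sb _ = sym (∧-identityʳ (s ∨ sb))

coVar-split-bits : (f x y : Bool) → (T y → T f) → (T (x ∧ y) → ⊥) → f ∧ not x ≡ (f ∧ not (x ∨ y)) ∨ y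
coVar-split-bits true  false false _   _    = refl
coVar-split-bits true  false true  _   _    = refl
coVar-split-bits true  true  false _   _    = refl
coVar-split-bits true  true  true  _   x#y  with () ← x#y _
coVar-split-bits false _     false _   _    = refl
coVar-split-bits false _     true  y⇒f _    with () ← y⇒f _

coVar-disjoint-bits : (f z w : Bool) → (T w → T z) → T ((f ∧ not z) ∧ w) → ⊥
coVar-disjoint-bits true false w w⇒z w∈ with () ← w⇒z w∈

module Children {nv m : ℕ} (F : Fin m → Clause nv) (tx ty : Tree (Vertex F))
  (vars-disjoint : Disjoint (varOf F tx) (varOf F ty))
  (clauses-disjoint : Disjoint (clOf F tx) (clOf F ty)) where

  tz : Tree (Vertex F)
  tz = node tx ty

  X Y coVz : Subset nv
  X = varOf F tx
  Y = varOf F ty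
  coVz = coVarOf F tz

  Cx Cy Cz : Subset m
  Cx = clOf F tx
  Cy = clOf F ty
  Cz = clOf F tz

  lookup-varOf-node : ∀ v → lookup (varOf F tz) v ≡ lookup X v ∨ lookup Y v
  lookup-varOf-node v = trans (lookup∘tabulate _ v) (sym (cong₂ _∨_ (lookup∘tabulate _ v) (lookup∘tabulate _ v)))

  lookup-clOf-node : ∀ c → lookup Cz c ≡ lookup Cx c ∨ lookup Cy c
  lookup-clOf-node c = trans (lookup∘tabulate _ c) (sym (cong₂ _∨_ (lookup∘tabulate _ c) (lookup∘tabulate _ c)))

  varOf-node : varOf F tz ≡ X ∪ Y
  varOf-node = lookup-injective _ _ (λ v → trans (lookup-varOf-node v) (sym (lookup-∪ X Y v)))

  lookup-coVarOf : (t : Tree (Vertex F)) (v : Fin nv) →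
                   lookup (coVarOf F t) v ≡ lookup (varF F) v ∧ not (lookup (varOf F t) v)
  lookup-coVarOf t v = trans (lookup-∩ (varF F) _ v) (cong (lookup (varF F) v ∧_) (lookup-∁ (varOf F t) v))

  lookup-coVz : ∀ v → lookup coVz v ≡ lookup (varF F) v ∧ not (lookup X v ∨ lookup Y v)
  lookup-coVz v = trans (lookup-coVarOf tz v) (cong (λ z → lookup (varF F) v ∧ not z) (lookup-varOf-node v))

  lookup-coVz-∪ : (W : Subset nv) (v : Fin nv) →
                  lookup (coVz ∪ W) v ≡ (lookup (varF F) v ∧ not (lookup X v ∨ lookup Y v)) ∨ lookup W v
  lookup-coVz-∪ W v = trans (lookup-∪ coVz W v) (cong (_∨ lookup W v) (lookup-coVz v))

  coVarOf-left : coVarOf F tx ≡ coVz ∪ Y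
  coVarOf-left = lookup-injective _ _ λ v → begin
      lookup (coVarOf F tx) v
    ≡⟨ lookup-coVarOf tx v ⟩
      lookup (varF F) v ∧ not (lookup X v)
    ≡⟨ coVar-split-bits _ _ _ (varOf⊆varF F ty v) (vars-disjoint v) ⟩
      (lookup (varF F) v ∧ not (lookup X v ∨ lookup Y v)) ∨ lookup Y v
    ≡⟨ sym (lookup-coVz-∪ Y v) ⟩
      lookup (coVz ∪ Y) v
    ∎

  coVarOf-right : coVarOf F ty ≡ coVz ∪ X
  coVarOf-right = lookup-injective _ _ λ v → begin
      lookup (coVarOf F ty) v
    ≡⟨ lookup-coVarOf ty v ⟩
      lookup (varF F) v ∧ not (lookup Y v)
    ≡⟨ coVar-split-bits _ _ _ (varOf⊆varF F tx v) (vars-disjoint v ∘ subst T (∧-comm (lookup Y v) (lookup X v))) ⟩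
      (lookup (varF F) v ∧ not (lookup Y v ∨ lookup X v)) ∨ lookup X v
    ≡⟨ cong (λ z → (lookup (varF F) v ∧ not z) ∨ lookup X v) (∨-comm (lookup Y v) (lookup X v)) ⟩
      (lookup (varF F) v ∧ not (lookup X v ∨ lookup Y v)) ∨ lookup X v
    ≡⟨ sym (lookup-coVz-∪ X v) ⟩
      lookup (coVz ∪ X) v
    ∎

  coVz-disjoint : (W : Subset nv) → (∀ v → T (lookup W v) → T (lookup X v ∨ lookup Y v)) → Disjoint coVz W
  coVz-disjoint W W⊆X∪Y v = coVar-disjoint-bits _ _ _ (W⊆X∪Y v) ∘ subst T (cong (_∧ lookup W v) (lookup-coVz v))

  coVz#Y : Disjoint coVz Y
  coVz#Y = coVz-disjoint Y (λ v → from (T-∨ {lookup X v}) ∘ inj₂)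

  coVz#X : Disjoint coVz X
  coVz#X = coVz-disjoint X (λ v → from (T-∨ {lookup X v}) ∘ inj₁)

  satisfies-node : (a b : Subset nv) → T ⌊ a ⊆? X ⌋ → T ⌊ b ⊆? Y ⌋ → (C : Clause nv) →
                   satisfies (varOf F tz) (a ∪ b) C ≡ satisfies X a C ∨ satisfies Y b C
  satisfies-node a b a⊆X b⊆Y C =
    trans (cong (λ Z → satisfies Z (a ∪ b) C) varOf-node) (satisfies-∪ X Y vars-disjoint a b a⊆X b⊆Y C)

  inP : Shape m → Shape m × Shape m → Bool
  inP s p = generates F tx ty (proj₁ p) (proj₂ p) s ∧ isProper F tx (proj₁ p) ∧ isProper F ty (proj₂ p)

  ofShapes : Shape m × Shape m → Subset nv → Subset nv → Bool
  ofShapes p a b = ofShape F tx (proj₁ p) a ∧ ofShape F ty (proj₂ p) b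

  module Split (inn : Subset m) (a b : Subset nv) (a⊆X : T ⌊ a ⊆? X ⌋) (b⊆Y : T ⌊ b ⊆? Y ⌋) where

    inLeft inRight : Subset m
    inLeft  = (inn ∪ outOf F ty b) ∩ Cx
    inRight = (inn ∪ outOf F tx a) ∩ Cy

    private
      cx cy sa sb : Fin m → Bool
      cx c = lookup Cx c
      cy c = lookup Cy c
      sa c = satisfies X a (F c)
      sb c = satisfies Y b (F c)

    lookup-inLeft : ∀ c → lookup inLeft c ≡ (lookup inn c ∨ (not (cy c) ∧ sb c)) ∧ cx c
    lookup-inLeft c = trans (lookup-∩ (inn ∪ outOf F ty b) Cx c) (cong (_∧ cx c)
      (trans (lookup-∪ inn (outOf F ty b) c) (cong (lookup inn c ∨_) (lookup-outOf F ty b c))))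

    lookup-inRight : ∀ c → lookup inRight c ≡ (lookup inn c ∨ (not (cx c) ∧ sa c)) ∧ cy c
    lookup-inRight c = trans (lookup-∩ (inn ∪ outOf F tx a) Cy c) (cong (_∧ cy c)
      (trans (lookup-∪ inn (outOf F tx a) c) (cong (lookup inn c ∨_) (lookup-outOf F tx a c))))

    out-node : outOf F tz (a ∪ b) ≡ (outOf F tx a ∪ outOf F ty b) ∩ ∁ Cz
    out-node = lookup-injective (outOf F tz (a ∪ b)) ((outOf F tx a ∪ outOf F ty b) ∩ ∁ Cz) λ c → begin
      lookup (outOf F tz (a ∪ b)) c
        ≡⟨ lookup-outOf F tz (a ∪ b) c ⟩
      not (lookup Cz c) ∧ satisfies (varOf F tz) (a ∪ b) (F c)
        ≡⟨ cong₂ (λ z s → not z ∧ s) (lookup-clOf-node c) (satisfies-node a b a⊆X b⊆Y (F c)) ⟩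
      not (cx c ∨ cy c) ∧ (sa c ∨ sb c)
        ≡⟨ out-bits (cx c) (cy c) (sa c) (sb c) ⟩
      ((not (cx c) ∧ sa c) ∨ (not (cy c) ∧ sb c)) ∧ not (cx c ∨ cy c)
        ≡⟨ sym (cong₂ _∧_ (trans (lookup-∪ (outOf F tx a) (outOf F ty b) c)
                                 (cong₂ _∨_ (lookup-outOf F tx a c) (lookup-outOf F ty b c)))
                          (trans (lookup-∁ Cz c) (cong not (lookup-clOf-node c)))) ⟩
      lookup (outOf F tx a ∪ outOf F ty b) c ∧ lookup (∁ Cz) c
        ≡⟨ sym (lookup-∩ (outOf F tx a ∪ outOf F ty b) (∁ Cz) c) ⟩
      lookup ((outOf F tx a ∪ outOf F ty b) ∩ ∁ Cz) c
        ∎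

    covers-node⇔ : Covers F tz inn (a ∪ b) ⇔ (Covers F tx inLeft a × Covers F ty inRight b)
    covers-node⇔ = mk⇔
      (λ h → (λ c → proj₁ (to (T-∧ {bitˣ c}) (subst T (split c) (h c))))
           , (λ c → proj₂ (to (T-∧ {bitˣ c}) (subst T (split c) (h c)))))
      (λ (hx , hy) c → subst T (sym (split c)) (from (T-∧ {bitˣ c}) (hx c , hy c)))
      where
      bitˣ bitʸ : Fin m → Bool
      bitˣ c = not (cx c) ∨ sa c ∨ lookup inLeft c
      bitʸ c = not (cy c) ∨ sb c ∨ lookup inRight c
      split : ∀ c → not (lookup Cz c) ∨ satisfies (varOf F tz) (a ∪ b) (F c) ∨ lookup inn c ≡ bitˣ c ∧ bitʸ c
      split c = begin
        not (lookup Cz c) ∨ satisfies (varOf F tz) (a ∪ b) (F c) ∨ lookup inn c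
          ≡⟨ cong₂ (λ z s → not z ∨ s ∨ lookup inn c) (lookup-clOf-node c) (satisfies-node a b a⊆X b⊆Y (F c)) ⟩
        not (cx c ∨ cy c) ∨ (sa c ∨ sb c) ∨ lookup inn c
          ≡⟨ sym (covers-bits (cx c) (cy c) (sa c) (sb c) (lookup inn c) (clauses-disjoint c)) ⟩
        (not (cx c) ∨ sa c ∨ ((lookup inn c ∨ (not (cy c) ∧ sb c)) ∧ cx c))
          ∧ (not (cy c) ∨ sb c ∨ ((lookup inn c ∨ (not (cx c) ∧ sa c)) ∧ cy c))
          ≡⟨ sym (cong₂ (λ l r → (not (cx c) ∨ sa c ∨ l) ∧ (not (cy c) ∨ sb c ∨ r))
                        (lookup-inLeft c) (lookup-inRight c)) ⟩
        bitˣ c ∧ bitʸ c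
          ∎

    module _ (σ : Subset nv) (σ⊆coVz : T ⌊ σ ⊆? coVz ⌋) (σ-in : satSet F Cz coVz σ ≡ inn) where

      private
        sσ : Fin m → Bool
        sσ c = satisfies coVz σ (F c)

        lookup-inn : ∀ c → lookup inn c ≡ (cx c ∨ cy c) ∧ sσ c
        lookup-inn c = trans (cong (λ i → lookup i c) (sym σ-in))
                             (trans (lookup-satSet F Cz coVz σ c) (cong (_∧ sσ c) (lookup-clOf-node c)))

      inLeft-proper : T (inProj F Cx (coVarOf F tx) inLeft)
      inLeft-proper = from (inProj⇔ F {Cx} {coVarOf F tx}) (σ ∪ b ,
        subst (λ V → T ⌊ (σ ∪ b) ⊆? V ⌋) (sym coVarOf-left) (∪-mono-⊆? σ⊆coVz b⊆Y) ,
        lookup-injective (satSet F Cx (coVarOf F tx) (σ ∪ b)) inLeft λ c → begin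
          lookup (satSet F Cx (coVarOf F tx) (σ ∪ b)) c
            ≡⟨ lookup-satSet F Cx (coVarOf F tx) (σ ∪ b) c ⟩
          cx c ∧ satisfies (coVarOf F tx) (σ ∪ b) (F c)
            ≡⟨ cong (λ V → cx c ∧ satisfies V (σ ∪ b) (F c)) coVarOf-left ⟩
          cx c ∧ satisfies (coVz ∪ Y) (σ ∪ b) (F c)
            ≡⟨ cong (cx c ∧_) (satisfies-∪ coVz Y coVz#Y σ b σ⊆coVz b⊆Y (F c)) ⟩
          cx c ∧ (sσ c ∨ sb c)
            ≡⟨ in-bits (cx c) (cy c) (sσ c) (sb c) (clauses-disjoint c) ⟩
          (((cx c ∨ cy c) ∧ sσ c) ∨ (not (cy c) ∧ sb c)) ∧ cx c
            ≡⟨ sym (trans (lookup-inLeft c) (cong (λ i → (i ∨ (not (cy c) ∧ sb c)) ∧ cx c) (lookup-inn c))) ⟩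
          lookup inLeft c
            ∎)

      inRight-proper : T (inProj F Cy (coVarOf F ty) inRight)
      inRight-proper = from (inProj⇔ F {Cy} {coVarOf F ty}) (σ ∪ a ,
        subst (λ V → T ⌊ (σ ∪ a) ⊆? V ⌋) (sym coVarOf-right) (∪-mono-⊆? σ⊆coVz a⊆X) ,
        lookup-injective (satSet F Cy (coVarOf F ty) (σ ∪ a)) inRight λ c → begin
          lookup (satSet F Cy (coVarOf F ty) (σ ∪ a)) c
            ≡⟨ lookup-satSet F Cy (coVarOf F ty) (σ ∪ a) c ⟩
          cy c ∧ satisfies (coVarOf F ty) (σ ∪ a) (F c)
            ≡⟨ cong (λ V → cy c ∧ satisfies V (σ ∪ a) (F c)) coVarOf-right ⟩
          cy c ∧ satisfies (coVz ∪ X) (σ ∪ a) (F c)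
            ≡⟨ cong (cy c ∧_) (satisfies-∪ coVz X coVz#X σ a σ⊆coVz a⊆X (F c)) ⟩
          cy c ∧ (sσ c ∨ sa c)
            ≡⟨ in-bits (cy c) (cx c) (sσ c) (sa c) (clauses-disjoint c ∘ subst T (∧-comm (cy c) (cx c))) ⟩
          (((cy c ∨ cx c) ∧ sσ c) ∨ (not (cx c) ∧ sa c)) ∧ cy c
            ≡⟨ cong (λ z → ((z ∧ sσ c) ∨ (not (cx c) ∧ sa c)) ∧ cy c) (∨-comm (cy c) (cx c)) ⟩
          (((cx c ∨ cy c) ∧ sσ c) ∨ (not (cx c) ∧ sa c)) ∧ cy c
            ≡⟨ sym (trans (lookup-inRight c) (cong (λ i → (i ∨ (not (cx c) ∧ sa c)) ∧ cy c) (lookup-inn c))) ⟩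
          lookup inRight c
            ∎)

      -- Once the out-parts are those of a and b, conditions (2) and (3) of Gen force the in-parts.
      canonical : Shape m × Shape m
      canonical = (outOf F tx a , inLeft) , (outOf F ty b , inRight)

      canonical-isShape : T (isShape F tx (proj₁ canonical)) × T (isShape F ty (proj₂ canonical))
      canonical-isShape =
          from (T-∧ {⌊ outOf F tx a ⊆? ∁ Cx ⌋}) (satSet⊆ F (∁ Cx) X a , fromWitness {a? = inLeft ⊆? Cx} (p∩q⊆q _ Cx))
        , from (T-∧ {⌊ outOf F ty b ⊆? ∁ Cy ⌋}) (satSet⊆ F (∁ Cy) Y b , fromWitness {a? = inRight ⊆? Cy} (p∩q⊆q _ Cy))

      inP∧ofShapes⇔ : {out : Subset m} {sx sy : Shape m} → T (inP (out , inn) (sx , sy) ∧ ofShapes (sx , sy) a b) ⇔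
        ((Generates F tx ty sx sy (out , inn) × T (isProper F tx sx) × T (isProper F ty sy))
         × T (ofShape F tx sx a) × T (ofShape F ty sy b))
      inP∧ofShapes⇔ {out} {sx} {sy} = mk⇔
        (λ h → let g&p , shapes = to (T-∧ {inP (out , inn) (sx , sy)}) h
                   g , p = to (T-∧ {generates F tx ty sx sy (out , inn)}) g&p
               in (to (generates⇔ F) g , to (T-∧ {isProper F tx sx}) p) , to (T-∧ {ofShape F tx sx a}) shapes)
        (λ ((g , px , py) , shx , shy) →
          from (T-∧ {inP (out , inn) (sx , sy)})
            ( from (T-∧ {generates F tx ty sx sy (out , inn)}) (from (generates⇔ F) g , from (T-∧ {isProper F tx sx}) (px , py))
            , from (T-∧ {ofShape F tx sx a}) (shx , shy)))

      inP∧ofShapes≡canonical : (out : Subset m) (p : Shape m × Shape m) →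
        inP (out , inn) p ∧ ofShapes p a b ≡ (p ≐ᵖ canonical) ∧ ofShape F tz (out , inn) (a ∪ b)
      inP∧ofShapes≡canonical out p@((ox , ix) , (oy , iy)) = T-injective fwd bwd
        where
        fwd : T (inP (out , inn) p ∧ ofShapes p a b) → T ((p ≐ᵖ canonical) ∧ ofShape F tz (out , inn) (a ∪ b))
        fwd h
          with (gen , _) , shx , shy ← to inP∧ofShapes⇔ h
          with refl , covx ← to (ofShape⇔ F {tx} {ox} {ix} {a}) shx
          with refl , covy ← to (ofShape⇔ F {ty} {oy} {iy} {b}) shy
          with record { out-node = out-eq ; in-left = refl ; in-right = refl } ← gen
          = from (T-∧ {canonical ≐ᵖ canonical})
              ( from (≐ᵖ⇔≡ {p = canonical}) refl
              , from (ofShape⇔ F {tz} {out} {inn} {a ∪ b}) (trans out-node (sym out-eq) , from covers-node⇔ (covx , covy)))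
        bwd : T ((p ≐ᵖ canonical) ∧ ofShape F tz (out , inn) (a ∪ b)) → T (inP (out , inn) p ∧ ofShapes p a b)
        bwd h
          with same , shz ← to (T-∧ {p ≐ᵖ canonical}) h
          with refl ← to (≐ᵖ⇔≡ {p = p} {canonical}) same
          with out-eq , covz ← to (ofShape⇔ F {tz} {out} {inn} {a ∪ b}) shz
          with covx , covy ← to covers-node⇔ covz
          = from inP∧ofShapes⇔
              ( (gen , proper-x , proper-y)
              , from (ofShape⇔ F {tx} {outOf F tx a} {inLeft} {a}) (refl , covx)
              , from (ofShape⇔ F {ty} {outOf F ty b} {inRight} {b}) (refl , covy))
          where
          gen : Generates F tx ty (proj₁ canonical) (proj₂ canonical) (out , inn)
          gen = record { left-isShape = proj₁ canonical-isShape ; right-isShape = proj₂ canonical-isShape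
                       ; out-node = trans (sym out-eq) out-node ; in-left = refl ; in-right = refl }
          proper-x : T (isProper F tx (proj₁ canonical))
          proper-x = from (T-∧ {inProj F (∁ Cx) X (outOf F tx a)}) (from (inProj⇔ F {∁ Cx} {X}) (a , a⊆X , refl) , inLeft-proper)
          proper-y : T (isProper F ty (proj₂ canonical))
          proper-y = from (T-∧ {inProj F (∁ Cy) Y (outOf F ty b)}) (from (inProj⇔ F {∁ Cy} {Y}) (b , b⊆Y , refl) , inRight-proper)

      ∑-inP : (out : Subset m) →
        ∑ (cartesianProduct (allShapes m) (allShapes m)) (λ p → guard (inP (out , inn) p) (iverson (ofShapes p a b)))
        ≡ iverson (ofShape F tz (out , inn) (a ∪ b))
      ∑-inP out = begin
          ∑ pairs (λ p → guard (inP (out , inn) p) (iverson (ofShapes p a b)))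
        ≡⟨ ∑-cong pairs (λ p → trans (guard≡iverson-* (inP (out , inn) p) _) (sym (iverson-∧ (inP (out , inn) p) _))) ⟩
          ∑ pairs (λ p → iverson (inP (out , inn) p ∧ ofShapes p a b))
        ≡⟨ ∑-cong pairs (λ p → trans (cong iverson (inP∧ofShapes≡canonical out p)) (iverson-∧ (p ≐ᵖ canonical) _)) ⟩
          ∑ pairs (λ p → iverson (p ≐ᵖ canonical) * iverson (ofShape F tz (out , inn) (a ∪ b)))
        ≡⟨ ∑-*ʳ pairs _ (λ p → iverson (p ≐ᵖ canonical)) ⟩
          ∑ pairs (λ p → iverson (p ≐ᵖ canonical)) * iverson (ofShape F tz (out , inn) (a ∪ b))
        ≡⟨ cong (_* iverson (ofShape F tz (out , inn) (a ∪ b))) (∑-allShapePairs-≐ᵖ canonical) ⟩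
          1 * iverson (ofShape F tz (out , inn) (a ∪ b))
        ≡⟨ *-identityˡ _ ⟩
          iverson (ofShape F tz (out , inn) (a ∪ b))
        ∎
        where
        pairs = cartesianProduct (allShapes m) (allShapes m)

  nShape≡sumOverP : (out inn : Subset m) → T (inProj F Cz coVz inn) →
                    nShape F tz (out , inn) ≡ sumOverP F tx ty (out , inn)
  nShape≡sumOverP out inn in-proper = let σ , σ⊆coVz , σ-in = to (inProj⇔ F {Cz} {coVz}) in-proper in begin
      nShape F tz s
    ≡⟨ nShape≡∑⊆ F tz s ⟩
      ∑⊆ (varOf F tz) (iverson ∘ ofShape F tz s)
    ≡⟨ cong (λ Z → ∑⊆ Z (iverson ∘ ofShape F tz s)) varOf-node ⟩
      ∑⊆ (X ∪ Y) (iverson ∘ ofShape F tz s)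
    ≡⟨ ∑⊆-∪ X Y vars-disjoint _ ⟩
      ∑⊆ X (λ a → ∑⊆ Y (λ b → iverson (ofShape F tz s (a ∪ b))))
    ≡⟨ ∑⊆-cong X (λ a a⊆X → ∑⊆-cong Y (λ b b⊆Y → sym (Split.∑-inP inn a b a⊆X b⊆Y σ σ⊆coVz σ-in out))) ⟩
      ∑⊆ X (λ a → ∑⊆ Y (λ b → ∑ pairs (λ p → guard (inP s p) (iverson (ofShapes p a b)))))
    ≡⟨ ∑⊆-cong X (λ a _ → ∑⊆-comm-∑ Y pairs _) ⟩
      ∑⊆ X (λ a → ∑ pairs (λ p → ∑⊆ Y (λ b → guard (inP s p) (iverson (ofShapes p a b)))))
    ≡⟨ ∑⊆-comm-∑ X pairs _ ⟩
      ∑ pairs (λ p → ∑⊆ X (λ a → ∑⊆ Y (λ b → guard (inP s p) (iverson (ofShapes p a b)))))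
    ≡⟨ ∑-cong pairs (λ p → trans (∑⊆-cong X (λ a _ → ∑⊆-guard Y (inP s p) _)) (∑⊆-guard X (inP s p) _)) ⟩
      ∑ pairs (λ p → guard (inP s p) (∑⊆ X (λ a → ∑⊆ Y (λ b → iverson (ofShapes p a b)))))
    ≡⟨ ∑-cong pairs (λ p → cong (guard (inP s p)) (sym (count-pair p))) ⟩
      ∑ pairs (λ p → guard (inP s p) (nShape F tx (proj₁ p) * nShape F ty (proj₂ p)))
    ≡⟨ sym (∑-filterᵇ (inP s) pairs _) ⟩
      sumOverP F tx ty s
    ∎
    where
    s : Shape m
    s = out , inn
    pairs : List (Shape m × Shape m)
    pairs = cartesianProduct (allShapes m) (allShapes m)
    count-pair : (p : Shape m × Shape m) →
                 nShape F tx (proj₁ p) * nShape F ty (proj₂ p) ≡ ∑⊆ X (λ a → ∑⊆ Y (λ b → iverson (ofShapes p a b)))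
    count-pair p = begin
        nShape F tx (proj₁ p) * nShape F ty (proj₂ p)
      ≡⟨ cong₂ _*_ (nShape≡∑⊆ F tx (proj₁ p)) (nShape≡∑⊆ F ty (proj₂ p)) ⟩
        ∑⊆ X (iverson ∘ ofShape F tx (proj₁ p)) * ∑⊆ Y (iverson ∘ ofShape F ty (proj₂ p))
      ≡⟨ ∑⊆-*-∑⊆ X Y _ _ ⟩
        ∑⊆ X (λ a → ∑⊆ Y (λ b → iverson (ofShape F tx (proj₁ p) a) * iverson (ofShape F ty (proj₂ p) b)))
      ≡⟨ ∑⊆-cong X (λ a _ → ∑⊆-cong Y (λ b _ → sym (iverson-∧ (ofShape F tx (proj₁ p) a) _))) ⟩
        ∑⊆ X (λ a → ∑⊆ Y (λ b → iverson (ofShapes p a b)))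
      ∎

corollary3 : (nv m : ℕ) (F : Fin m → Clause nv) → Injective _≡_ _≡_ F →
    (T₀ : Tree (Vertex F)) → IsDecompTree F T₀ →
    (tx ty : Tree (Vertex F)) → node tx ty ≼ T₀ →
    (s : Shape m) → T (isShape F (node tx ty) s) → T (isProper F (node tx ty) s) →
    nShape F (node tx ty) s ≡ sumOverP F tx ty s
corollary3 nv m F _ T₀ (_ , leaves-unique) tx ty z≼T₀ (out , inn) _ proper =
  Children.nShape≡sumOverP F tx ty (varOf-disjoint F tx ty unique) (clOf-disjoint F tx ty unique) out inn in-proper
  where
  unique : Unique (leaves tx ++ leaves ty)
  unique = Unique-≼ z≼T₀ leaves-unique
  in-proper : T (inProj F (clOf F (node tx ty)) (coVarOf F (node tx ty)) inn)
  in-proper = proj₂ (to (T-∧ {inProj F (∁ (clOf F (node tx ty))) (varOf F (node tx ty)) out}) proper)
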